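{- Let $n\ge 1$ and let $G_0,\dots,G_n$ be $s$-graphs, and for each $i$ let $e_i=v_iw_i\in E(G_i)$. Let $G=\sum_{i=0}^n G_i$ be the graph obtained from the disjoint union of the graphs $G_i-e_i$ ($0\le i\le n$) by adding edges as follows: if $n=2k$, add the edges $v_{2j}v_{2j+1}$ and $w_{2j+1}w_{2j+2}$ for $0\le j\le k-1$, and the edge $v_{2k}w_0$; if $n=2k-1$, add the edges $v_{2j}v_{2j+1}$ and $w_{2j+1}w_{2j+2}$ for $0\le j\le k-1$, with indices taken modulo $2k$. Then $G$ is an $s$-graph.
   Context: Graphs are finite, may have multiple edges but no loops. An $s$-graph is an $s$-regular graph $G$ such that $|\partial_G(X)|\ge s$ for every subset $X\subseteq V(G)$ of odd cardinality, where $\partial_G(X)$ is the set of edges of $G$ joining $X$ to $V(G)\setminus X$. -}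

module Defs where

open import Data.Nat using (ℕ; zero; suc; _+_; _*_; _≤_; _%_; _/_; _≡ᵇ_)
open import Data.Nat.DivMod using (_mod_)
open import Data.Fin using (Fin; zero; suc; _↑ˡ_; _↑ʳ_; fromℕ<; _≟_)
open import Data.Fin.Subset using (Subset; ∣_∣)
open import Data.Vec using (lookup)
open import Data.List using (List; []; _∷_; _++_; map; concat; length; filterᵇ; removeAt; upTo; concatMap)
open import Data.List.Relation.Unary.All using (All)
open import Data.Product using (_×_; _,_; proj₁; proj₂)
open import Data.Bool using (Bool; true; false; _∨_; _xor_; if_then_else_)
open import Relation.Nullary using (¬_)
open import Relation.Nullary.Decidable using (⌊_⌋)
open import Relation.Binary.PropositionalEquality using (_≡_)

-- A finite multigraph on vertex set Fin N, given by its list of edges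
-- (each edge an (unordered) pair of endpoints; parallel edges = repeated entries).
record Graph : Set where
  constructor mkGraph
  field
    N : ℕ
    E : List (Fin N × Fin N)
open Graph public

Loopless : Graph → Set
Loopless G = All (λ e → ¬ (proj₁ e ≡ proj₂ e)) (E G)

degree : (G : Graph) → Fin (N G) → ℕ
degree G v = length (filterᵇ (λ e → ⌊ v ≟ proj₁ e ⌋ ∨ ⌊ v ≟ proj₂ e ⌋) (E G))

cutSize : (G : Graph) → Subset (N G) → ℕ
cutSize G X = length (filterᵇ (λ e → lookup X (proj₁ e) xor lookup X (proj₂ e)) (E G))

record IsSGraph (s : ℕ) (G : Graph) : Set where
  field
    loopless : Loopless G
    regular  : ∀ v → degree G v ≡ s
    oddCuts  : ∀ (X : Subset (N G)) → ∣ X ∣ % 2 ≡ 1 → s ≤ cutSize G X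

total : (k : ℕ) → (Fin k → Graph) → ℕ
total zero    G = 0
total (suc k) G = N (G zero) + total k (λ i → G (suc i))

emb : (k : ℕ) (G : Fin k → Graph) (i : Fin k) → Fin (N (G i)) → Fin (total k G)
emb (suc k) G zero    x = x ↑ˡ total k (λ i → G (suc i))
emb (suc k) G (suc i) x = N (G zero) ↑ʳ emb k (λ j → G (suc j)) i x

unionMinus : (k : ℕ) (G : Fin k → Graph) (e : (i : Fin k) → Fin (length (E (G i))))
  → List (Fin (total k G) × Fin (total k G))
unionMinus zero    G e = []
unionMinus (suc k) G e =
  map (λ p → emb (suc k) G zero (proj₁ p) , emb (suc k) G zero (proj₂ p))
      (removeAt (E (G zero)) (e zero))
  ++ map (λ p → (N (G zero) ↑ʳ proj₁ p) , (N (G zero) ↑ʳ proj₂ p))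
         (unionMinus k (λ i → G (suc i)) (λ i → e (suc i)))

module _ (n : ℕ) (G : Fin (suc n) → Graph)
         (e : (i : Fin (suc n)) → Fin (length (E (G i))))
         (v w : (i : Fin (suc n)) → Fin (N (G i))) where

  V : Set
  V = Fin (total (suc n) G)

  idx : ℕ → Fin (suc n)
  idx i = i mod (suc n)

  vv ww : ℕ → V
  vv i = emb (suc n) G (idx i) (v (idx i))
  ww i = emb (suc n) G (idx i) (w (idx i))

  pairEdges : ℕ → (ℕ → ℕ) → List (V × V)
  pairEdges k f = concatMap (λ j → (vv (2 * j) , vv (suc (2 * j)))
                                 ∷ (ww (suc (2 * j)) , ww (f (2 + 2 * j))) ∷ [])
                            (upTo k)

  addedEven : ℕ → List (V × V)
  addedEven k = pairEdges k (λ i → i) ++ ((vv (2 * k) , ww 0) ∷ [])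

  addedOdd : ℕ → List (V × V)
  addedOdd zero    = []
  addedOdd (suc k) = pairEdges (suc k) (λ i → i % (2 * suc k))

  added : List (V × V)
  added = if n % 2 ≡ᵇ 0 then addedEven (n / 2) else addedOdd (suc n / 2)

  SumGraph : Graph
  SumGraph = mkGraph (total (suc n) G) (unionMinus (suc n) G e ++ added)

-- Every vertex keeps degree s: in block i only e_i = v_i w_i is deleted, and among the
-- added edges v_i and w_i each lie on exactly one, because every index 0 … n occurs once
-- on the v side and once on the w side. For an odd set X some block X ∩ V(G_i) is odd,
-- so s ≤ |∂_{G_i}(X ∩ V(G_i))| ≤ |∂_G(X)| + 1, as e_i is the only edge of G_i missing
-- from G. The handshake identity gives |∂_G(X)| ≡ s·|X| ≡ s (mod 2), which excludes
-- |∂_G(X)| = s - 1.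

module Submission where

open import Defs
open import Data.Bool using (Bool; true; false; _∨_; _∧_; _xor_; if_then_else_; T?)
open import Data.Empty using (⊥-elim)
open import Data.Fin using (Fin; zero; suc; toℕ; _≟_; _↑ˡ_; _↑ʳ_; splitAt; join; punchIn)
open import Data.Fin.Properties
  using ( toℕ-fromℕ<; toℕ-injective; toℕ<n; punchInᵢ≢i
        ; splitAt-↑ˡ; splitAt-↑ʳ; join-splitAt; ↑ˡ-injective; ↑ʳ-injective )
open import Data.Fin.Subset using (Subset; ∣_∣)
open import Data.List using (List; []; _∷_; _++_; map; length; filterᵇ; removeAt; lookup; upTo; concatMap)
open import Data.List.Membership.Propositional.Properties using (∈-lookup)
open import Data.List.Properties using (length-++; filter-++; concatMap-++; upTo-∷ʳ; ++-identityʳ)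
open import Data.List.Relation.Unary.All as All using (All; []; _∷_)
open import Data.List.Relation.Unary.All.Properties using (++⁺; map⁺; concat⁺; applyUpTo⁺₂)
open import Data.Nat using (ℕ; zero; suc; _+_; _*_; _≤_; _<_; _%_; _/_; _≡ᵇ_; z≤n; s≤s; NonZero)
open import Data.Nat.DivMod
open import Data.Nat.Properties hiding (_≟_)
open import Algebra.Properties.Semiring.Sum +-*-semiring
  using (sum; sum-cong-≗; sum-remove; sum-replicate-zero; ∑-distrib-+; *-distribʳ-sum)
open import Data.Nat.Tactic.RingSolver using (solve-∀)
open import Data.Product using (_×_; _,_; proj₁; proj₂; ∃)
open import Data.Sum using (_⊎_; inj₁; inj₂)
open import Data.Vec using (tabulate) renaming (lookup to lookupᵛ; [] to []ᵛ; _∷_ to _∷ᵛ_)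
open import Data.Vec.Properties using (lookup∘tabulate)
open import Function using (_∘_)
open import Relation.Nullary using (yes; no)
open import Relation.Nullary.Decidable using (⌊_⌋)
open import Relation.Binary.PropositionalEquality hiding ([_])

[_] : Bool → ℕ
[ true ]  = 1
[ false ] = 0

[]≤1 : ∀ b → [ b ] ≤ 1
[]≤1 true  = s≤s z≤n
[]≤1 false = z≤n

[]-∧ : ∀ a b → [ a ∧ b ] ≡ [ a ] * [ b ]
[]-∧ true  b = sym (+-identityʳ [ b ])
[]-∧ false b = refl

[]-xor : ∀ a b → [ a xor b ] + 2 * [ a ∧ b ] ≡ [ a ] + [ b ]
[]-xor true  true  = refl
[]-xor true  false = refl
[]-xor false true  = refl
[]-xor false false = refl

count : {A : Set} → (A → Bool) → List A → ℕ
count p xs = length (filterᵇ p xs)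

module _ {A : Set} where

  count-∷ : (p : A → Bool) (x : A) (xs : List A) → count p (x ∷ xs) ≡ [ p x ] + count p xs
  count-∷ p x xs with p x
  ... | true  = refl
  ... | false = refl

  count-++ : (p : A → Bool) (xs ys : List A) → count p (xs ++ ys) ≡ count p xs + count p ys
  count-++ p xs ys = trans (cong length (filter-++ (T? ∘ p) xs ys)) (length-++ (filterᵇ p xs))

  count-cong : {p q : A → Bool} → (∀ x → p x ≡ q x) → (xs : List A) → count p xs ≡ count q xs
  count-cong p≗q []       = refl
  count-cong {p} {q} p≗q (x ∷ xs) = begin
    count p (x ∷ xs)         ≡⟨ count-∷ p x xs ⟩
    [ p x ] + count p xs     ≡⟨ cong₂ _+_ (cong [_] (p≗q x)) (count-cong p≗q xs) ⟩
    [ q x ] + count q xs     ≡⟨ count-∷ q x xs ⟨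
    count q (x ∷ xs)         ∎
    where open ≡-Reasoning

  count-zero : {p : A → Bool} (xs : List A) → (∀ x → p x ≡ false) → count p xs ≡ 0
  count-zero {p} xs p≗false = trans (count-cong p≗false xs) (count-false xs)
    where
    count-false : (xs : List A) → count (λ _ → false) xs ≡ 0
    count-false []       = refl
    count-false (x ∷ xs) = count-false xs

  count-removeAt : (p : A → Bool) (xs : List A) (k : Fin (length xs))
    → count p xs ≡ count p (removeAt xs k) + [ p (lookup xs k) ]
  count-removeAt p (x ∷ xs) zero    = trans (count-∷ p x xs) (+-comm [ p x ] _)
  count-removeAt p (x ∷ xs) (suc k) = begin
    count p (x ∷ xs)                                        ≡⟨ count-∷ p x xs ⟩
    [ p x ] + count p xs                                    ≡⟨ cong ([ p x ] +_) (count-removeAt p xs k) ⟩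
    [ p x ] + (count p (removeAt xs k) + [ p (lookup xs k) ]) ≡⟨ +-assoc [ p x ] _ _ ⟨
    [ p x ] + count p (removeAt xs k) + [ p (lookup xs k) ] ≡⟨ cong (_+ _) (count-∷ p x (removeAt xs k)) ⟨
    count p (x ∷ removeAt xs k) + [ p (lookup xs k) ]       ∎
    where open ≡-Reasoning

  All-removeAt : {P : A → Set} (xs : List A) (k : Fin (length xs)) → All P xs → All P (removeAt xs k)
  All-removeAt (x ∷ xs) zero    (px ∷ pxs) = pxs
  All-removeAt (x ∷ xs) (suc k) (px ∷ pxs) = px ∷ All-removeAt xs k pxs

count-map : {A B : Set} (p : B → Bool) (f : A → B) (xs : List A) → count p (map f xs) ≡ count (p ∘ f) xs
count-map p f []       = refl
count-map p f (x ∷ xs) =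
  trans (count-∷ p (f x) (map f xs)) (trans (cong ([ p (f x) ] +_) (count-map p f xs)) (sym (count-∷ (p ∘ f) x xs)))

concatMap-upTo-suc : {B : Set} (g : ℕ → List B) (k : ℕ) → concatMap g (upTo (suc k)) ≡ concatMap g (upTo k) ++ g k
concatMap-upTo-suc g k = begin
  concatMap g (upTo (suc k))                     ≡⟨ cong (concatMap g) (upTo-∷ʳ k) ⟨
  concatMap g (upTo k ++ k ∷ [])                 ≡⟨ concatMap-++ g (upTo k) (k ∷ []) ⟩
  concatMap g (upTo k) ++ (g k ++ [])            ≡⟨ cong (concatMap g (upTo k) ++_) (++-identityʳ (g k)) ⟩
  concatMap g (upTo k) ++ g k                    ∎
  where open ≡-Reasoning

sumBelow : (ℕ → ℕ) → ℕ → ℕ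
sumBelow f zero    = 0
sumBelow f (suc k) = sumBelow f k + f k

sumBelow-zero : (f : ℕ → ℕ) (k : ℕ) → (∀ m → m < k → f m ≡ 0) → sumBelow f k ≡ 0
sumBelow-zero f zero    zeros = refl
sumBelow-zero f (suc k) zeros = cong₂ _+_ (sumBelow-zero f k (λ m m<k → zeros m (m<n⇒m<1+n m<k))) (zeros k (n<1+n k))

sumBelow-single : (f : ℕ → ℕ) {t k : ℕ} → t < k → (∀ m → m < k → m ≢ t → f m ≡ 0) → sumBelow f k ≡ f t
sumBelow-single f {t} {suc k} t<1+k zeros with m≤n⇒m<n∨m≡n (≤-pred t<1+k)
... | inj₁ t<k = begin
  sumBelow f k + f k ≡⟨ cong₂ _+_ (sumBelow-single f t<k (λ m m<k → zeros m (m<n⇒m<1+n m<k)))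
                                  (zeros k (n<1+n k) (λ k≡t → <⇒≢ t<k (sym k≡t))) ⟩
  f t + 0            ≡⟨ +-identityʳ (f t) ⟩
  f t                ∎
  where open ≡-Reasoning
... | inj₂ refl = cong (_+ f t) (sumBelow-zero f t (λ m m<t → zeros m (m<n⇒m<1+n m<t) (<⇒≢ m<t)))

sumBelow-shift : (f : ℕ → ℕ) (k : ℕ) → f 0 + sumBelow (f ∘ suc) k ≡ sumBelow f k + f k
sumBelow-shift f zero    = +-identityʳ (f 0)
sumBelow-shift f (suc k) = trans (sym (+-assoc (f 0) _ _)) (cong (_+ f (suc k)) (sumBelow-shift f k))

sumBelow-rotate : (f : ℕ → ℕ) (k : ℕ) → f k ≡ f 0 → sumBelow (f ∘ suc) k ≡ sumBelow f k
sumBelow-rotate f k fk≡f0 = +-cancelˡ-≡ (f 0) _ _ (begin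
  f 0 + sumBelow (f ∘ suc) k ≡⟨ sumBelow-shift f k ⟩
  sumBelow f k + f k         ≡⟨ cong (sumBelow f k +_) fk≡f0 ⟩
  sumBelow f k + f 0         ≡⟨ +-comm (sumBelow f k) (f 0) ⟩
  f 0 + sumBelow f k         ∎)
  where open ≡-Reasoning

%-suc-≢ : ∀ d m → m % suc (suc d) ≢ suc m % suc (suc d)
%-suc-≢ d m = residue-cases (m≤n⇒m<n∨m≡n (m%n<n m D))
  where
  D = suc (suc d)
  r = m % D
  suc-% : suc m % D ≡ suc r % D
  suc-% = trans (%-distribˡ-+ 1 m D) (cong (λ t → (t + r) % D) (m<n⇒m%n≡m {n = D} (s≤s (s≤s z≤n))))
  residue-cases : suc r < D ⊎ suc r ≡ D → r ≢ suc m % D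
  residue-cases (inj₁ 1+r<D) r≡ = <⇒≢ (n<1+n r) (trans r≡ (trans suc-% (m<n⇒m%n≡m 1+r<D)))
  residue-cases (inj₂ 1+r≡D) r≡ = 0≢1+n (trans (sym r≡0) (suc-injective 1+r≡D))
    where
    r≡0 : r ≡ 0
    r≡0 = trans r≡ (trans suc-% (trans (cong (_% D) 1+r≡D) (n%n≡0 D)))

toℕ-mod : ∀ m d .{{_ : NonZero d}} → toℕ (m mod d) ≡ m % d
toℕ-mod m d = toℕ-fromℕ< (m%n<n m d)

mod-suc-≢ : ∀ n m → 1 ≤ n → m mod suc n ≢ suc m mod suc n
mod-suc-≢ (suc d) m _ eq = %-suc-≢ d m (trans (sym (toℕ-mod m _)) (trans (cong toℕ eq) (toℕ-mod (suc m) _)))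

%-mod : ∀ m d .{{_ : NonZero d}} → (m % d) mod d ≡ m mod d
%-mod m d = toℕ-injective (trans (toℕ-mod (m % d) d) (trans (m%n%n≡m%n m d) (sym (toℕ-mod m d))))

toℕ[i]mod[1+n]≡i : ∀ n (i : Fin (suc n)) → toℕ i mod suc n ≡ i
toℕ[i]mod[1+n]≡i n i = toℕ-injective (trans (toℕ-mod (toℕ i) (suc n)) (m<n⇒m%n≡m (toℕ<n i)))

[1+n]mod[1+n]≡0 : ∀ n → suc n mod suc n ≡ zero
[1+n]mod[1+n]≡0 n = toℕ-injective (trans (toℕ-mod (suc n) (suc n)) (n%n≡0 (suc n)))

sumBelow-mod-indicator : ∀ n (i : Fin (suc n)) → sumBelow (λ m → [ ⌊ i ≟ m mod suc n ⌋ ]) (suc n) ≡ 1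
sumBelow-mod-indicator n i = trans (sumBelow-single _ (toℕ<n i) off-i) at-i
  where
  off-i : ∀ m → m < suc n → m ≢ toℕ i → [ ⌊ i ≟ m mod suc n ⌋ ] ≡ 0
  off-i m m<1+n m≢i with i ≟ m mod suc n
  ... | yes i≡m = ⊥-elim (m≢i (sym (trans (cong toℕ i≡m) (trans (toℕ-mod m (suc n)) (m<n⇒m%n≡m m<1+n)))))
  ... | no  _   = refl
  at-i : [ ⌊ i ≟ toℕ i mod suc n ⌋ ] ≡ 1
  at-i with i ≟ toℕ i mod suc n
  ... | yes _   = refl
  ... | no  i≢i = ⊥-elim (i≢i (sym (toℕ[i]mod[1+n]≡i n i)))

%2-cases : ∀ x → x % 2 ≡ 0 ⊎ x % 2 ≡ 1
%2-cases x with x % 2 | m%n<n x 2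
... | 0           | _ = inj₁ refl
... | 1           | _ = inj₂ refl
... | suc (suc _) | s≤s (s≤s ())

odd-+ : ∀ x y → (x + y) % 2 ≡ 1 → x % 2 ≡ 1 ⊎ y % 2 ≡ 1
odd-+ x y odd with %2-cases x | %2-cases y
... | inj₂ x-odd | _          = inj₁ x-odd
... | _          | inj₂ y-odd = inj₂ y-odd
... | inj₁ x-even | inj₁ y-even
  with trans (sym odd) (trans (%-distribˡ-+ x y 2) (cong₂ (λ a b → (a + b) % 2) x-even y-even))
... | ()

c+2i≡sa⇒c%2≡s%2 : ∀ c i s a → c + 2 * i ≡ s * a → a % 2 ≡ 1 → c % 2 ≡ s % 2
c+2i≡sa⇒c%2≡s%2 c i s a eq a-odd = begin
  c % 2                   ≡⟨ [m+kn]%n≡m%n c i 2 ⟨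
  (c + i * 2) % 2         ≡⟨ cong (λ t → (c + t) % 2) (*-comm i 2) ⟩
  (c + 2 * i) % 2         ≡⟨ cong (_% 2) eq ⟩
  (s * a) % 2             ≡⟨ %-distribˡ-* s a 2 ⟩
  (s % 2 * (a % 2)) % 2   ≡⟨ cong (λ t → (s % 2 * t) % 2) a-odd ⟩
  (s % 2 * 1) % 2         ≡⟨ cong (_% 2) (*-identityʳ (s % 2)) ⟩
  s % 2 % 2               ≡⟨ m%n%n≡m%n s 2 ⟩
  s % 2                   ∎
  where open ≡-Reasoning

≤-suc-same-parity⇒≤ : ∀ s c → s ≤ suc c → c % 2 ≡ s % 2 → s ≤ c
≤-suc-same-parity⇒≤ s c s≤1+c same with m≤n⇒m<n∨m≡n s≤1+c
... | inj₁ s<1+c = ≤-pred s<1+c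
... | inj₂ refl  = ⊥-elim (%-suc-≢ 0 c same)

halve : ∀ n → (∃ λ k → n ≡ k * 2) ⊎ (∃ λ k → n ≡ suc (k * 2))
halve zero    = inj₁ (0 , refl)
halve (suc n) with halve n
... | inj₁ (k , n≡2k)   = inj₂ (k , cong suc n≡2k)
... | inj₂ (k , n≡1+2k) = inj₁ (suc k , cong suc n≡1+2k)

even-or-odd : ∀ n → (∃ λ k → (n % 2 ≡ᵇ 0) ≡ true × n / 2 ≡ k × 2 * k ≡ n)
                  ⊎ (∃ λ k → (n % 2 ≡ᵇ 0) ≡ false × suc n / 2 ≡ suc k × 2 * suc k ≡ suc n)
even-or-odd n with halve n
... | inj₁ (k , refl) = inj₁ (k , cong (_≡ᵇ 0) (m*n%n≡0 k 2) , m*n/n≡m k 2 , *-comm 2 k)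
... | inj₂ (k , refl) = inj₂ (k , cong (_≡ᵇ 0) ([m+kn]%n≡m%n 1 k 2) , m*n/n≡m (suc k) 2 , *-comm 2 (suc k))

sum-↑ : ∀ a b (f : Fin (a + b) → ℕ) → sum f ≡ sum (f ∘ (_↑ˡ b)) + sum (f ∘ (a ↑ʳ_))
sum-↑ zero    b f = refl
sum-↑ (suc a) b f = trans (cong (f zero +_) (sum-↑ a b (f ∘ suc))) (sym (+-assoc (f zero) _ _))

sum-zero : ∀ {N} (f : Fin N → ℕ) → (∀ x → f x ≡ 0) → sum f ≡ 0
sum-zero {N} f zeros = trans (sum-cong-≗ zeros) (sum-replicate-zero N)

sum≡term : ∀ {N} (f : Fin N → ℕ) (i : Fin N) → (∀ j → j ≢ i → f j ≡ 0) → sum f ≡ f i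
sum≡term {suc N} f i zeros = begin
  sum f                                        ≡⟨ sum-remove f ⟩
  f i + sum (λ j → f (punchIn i j))            ≡⟨ cong (f i +_) (sum-zero _ (λ j → zeros _ (punchInᵢ≢i i j))) ⟩
  f i + 0                                      ≡⟨ +-identityʳ (f i) ⟩
  f i                                          ∎
  where open ≡-Reasoning

term≤sum : ∀ {N} (f : Fin N → ℕ) (i : Fin N) → f i ≤ sum f
term≤sum {suc N} f i = ≤-trans (m≤m+n (f i) _) (≤-reflexive (sym (sum-remove f)))

sum-indicator : ∀ {N} (f : Fin N → ℕ) (a : Fin N) → sum (λ x → f x * [ ⌊ x ≟ a ⌋ ]) ≡ f a
sum-indicator f a = trans (sum≡term _ a off-a) at-a
  where
  off-a : ∀ x → x ≢ a → f x * [ ⌊ x ≟ a ⌋ ] ≡ 0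
  off-a x x≢a with x ≟ a
  ... | yes x≡a = ⊥-elim (x≢a x≡a)
  ... | no  _   = *-zeroʳ (f x)
  at-a : f a * [ ⌊ a ≟ a ⌋ ] ≡ f a
  at-a with a ≟ a
  ... | yes _   = *-identityʳ (f a)
  ... | no  a≢a = ⊥-elim (a≢a refl)

sum-odd⇒term-odd : ∀ {N} (f : Fin N → ℕ) → sum f % 2 ≡ 1 → ∃ λ i → f i % 2 ≡ 1
sum-odd⇒term-odd {zero}  f ()
sum-odd⇒term-odd {suc N} f odd with odd-+ (f zero) (sum (f ∘ suc)) odd
... | inj₁ head-odd = zero , head-odd
... | inj₂ tail-odd with sum-odd⇒term-odd (f ∘ suc) tail-odd
...   | i , fi-odd = suc i , fi-odd

∣X∣≡sum : ∀ {N} (X : Subset N) → ∣ X ∣ ≡ sum (λ x → [ lookupᵛ X x ])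
∣X∣≡sum []ᵛ          = refl
∣X∣≡sum (true ∷ᵛ X)  = cong suc (∣X∣≡sum X)
∣X∣≡sum (false ∷ᵛ X) = ∣X∣≡sum X

-- Edge lists and the handshake identity

NonLoop : ∀ {N} → Fin N × Fin N → Set
NonLoop e = proj₁ e ≢ proj₂ e

incident : ∀ {N} → Fin N → Fin N × Fin N → Bool
incident x e = ⌊ x ≟ proj₁ e ⌋ ∨ ⌊ x ≟ proj₂ e ⌋

crosses inside : ∀ {N} → (Fin N → Bool) → Fin N × Fin N → Bool
crosses X e = X (proj₁ e) xor X (proj₂ e)
inside  X e = X (proj₁ e) ∧ X (proj₂ e)

[incident] : ∀ {N} (x : Fin N) {a b : Fin N} → a ≢ b → [ incident x (a , b) ] ≡ [ ⌊ x ≟ a ⌋ ] + [ ⌊ x ≟ b ⌋ ]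
[incident] x {a} {b} a≢b with x ≟ a | x ≟ b
... | yes x≡a | yes x≡b = ⊥-elim (a≢b (trans (sym x≡a) x≡b))
... | yes _   | no  _   = refl
... | no  _   | yes _   = refl
... | no  _   | no  _   = refl

sum-incident : ∀ {N} (f : Fin N → ℕ) {a b : Fin N} → a ≢ b → sum (λ x → f x * [ incident x (a , b) ]) ≡ f a + f b
sum-incident f {a} {b} a≢b = begin
  sum (λ x → f x * [ incident x (a , b) ])          ≡⟨ sum-cong-≗ split ⟩
  sum (λ x → fa x + fb x)                            ≡⟨ ∑-distrib-+ fa fb ⟩
  sum fa + sum fb                                    ≡⟨ cong₂ _+_ (sum-indicator f a) (sum-indicator f b) ⟩
  f a + f b                                          ∎
  where
  open ≡-Reasoning
  fa fb : Fin _ → ℕ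
  fa x = f x * [ ⌊ x ≟ a ⌋ ]
  fb x = f x * [ ⌊ x ≟ b ⌋ ]
  split : ∀ x → f x * [ incident x (a , b) ] ≡ f x * [ ⌊ x ≟ a ⌋ ] + f x * [ ⌊ x ≟ b ⌋ ]
  split x = trans (cong (f x *_) ([incident] x a≢b)) (*-distribˡ-+ (f x) _ _)

handshake : ∀ {N} (X : Fin N → Bool) (L : List (Fin N × Fin N)) → All NonLoop L
  → count (crosses X) L + 2 * count (inside X) L ≡ sum (λ x → [ X x ] * count (incident x) L)
handshake {N} X [] [] = sym (sum-zero _ (λ x → *-zeroʳ [ X x ]))
handshake {N} X ((a , b) ∷ L) (a≢b ∷ L-nonloop) = begin
  count (crosses X) ((a , b) ∷ L) + 2 * count (inside X) ((a , b) ∷ L)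
    ≡⟨ cong₂ (λ c i → c + 2 * i) (count-∷ (crosses X) (a , b) L) (count-∷ (inside X) (a , b) L) ⟩
  [ X a xor X b ] + count (crosses X) L + 2 * ([ X a ∧ X b ] + count (inside X) L)
    ≡⟨ regroup [ X a xor X b ] (count (crosses X) L) [ X a ∧ X b ] (count (inside X) L) ⟩
  ([ X a xor X b ] + 2 * [ X a ∧ X b ]) + (count (crosses X) L + 2 * count (inside X) L)
    ≡⟨ cong₂ _+_ (trans ([]-xor (X a) (X b)) (sym (sum-incident (λ x → [ X x ]) a≢b))) (handshake X L L-nonloop) ⟩
  sum (λ x → [ X x ] * [ incident x (a , b) ]) + sum (λ x → [ X x ] * count (incident x) L)
    ≡⟨ ∑-distrib-+ (λ x → [ X x ] * [ incident x (a , b) ]) (λ x → [ X x ] * count (incident x) L) ⟨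
  sum (λ x → [ X x ] * [ incident x (a , b) ] + [ X x ] * count (incident x) L)
    ≡⟨ sum-cong-≗ (λ x → trans (sym (*-distribˡ-+ [ X x ] _ _)) (cong ([ X x ] *_) (sym (count-∷ (incident x) (a , b) L)))) ⟩
  sum (λ x → [ X x ] * count (incident x) ((a , b) ∷ L)) ∎
  where
  open ≡-Reasoning
  regroup : ∀ p c q i → p + c + 2 * (q + i) ≡ (p + 2 * q) + (c + 2 * i)
  regroup = solve-∀

cutSize-parity : ∀ {s} (G : Graph) → Loopless G → (∀ v → degree G v ≡ s)
  → (X : Subset (N G)) → ∣ X ∣ % 2 ≡ 1 → cutSize G X % 2 ≡ s % 2
cutSize-parity {s} G loopless regular X odd = c+2i≡sa⇒c%2≡s%2 (cutSize G X) (count (inside (lookupᵛ X)) (E G)) s ∣ X ∣ (begin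
  cutSize G X + 2 * count (inside (lookupᵛ X)) (E G)         ≡⟨ handshake (lookupᵛ X) (E G) loopless ⟩
  sum (λ x → [ lookupᵛ X x ] * degree G x)                  ≡⟨ sum-cong-≗ (λ x → cong ([ lookupᵛ X x ] *_) (regular x)) ⟩
  sum (λ x → [ lookupᵛ X x ] * s)                           ≡⟨ *-distribʳ-sum s (λ x → [ lookupᵛ X x ]) ⟨
  sum (λ x → [ lookupᵛ X x ]) * s                           ≡⟨ cong (_* s) (∣X∣≡sum X) ⟨
  ∣ X ∣ * s                                                 ≡⟨ *-comm ∣ X ∣ s ⟩
  s * ∣ X ∣                                                 ∎) odd
  where open ≡-Reasoning

-- Disjoint unions

embEdge : ∀ k (G : Fin k → Graph) (i : Fin k) → Fin (N (G i)) × Fin (N (G i)) → Fin (total k G) × Fin (total k G)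
embEdge k G i p = emb k G i (proj₁ p) , emb k G i (proj₂ p)

emb-injectiveˡ : ∀ k (G : Fin k → Graph) {i j} a b → emb k G i a ≡ emb k G j b → i ≡ j
emb-injectiveˡ (suc k) G {zero}  {zero}  a b eq = refl
emb-injectiveˡ (suc k) G {zero}  {suc j} a b eq
  with trans (sym (splitAt-↑ˡ (N (G zero)) a _)) (trans (cong (splitAt (N (G zero))) eq) (splitAt-↑ʳ (N (G zero)) _ _))
... | ()
emb-injectiveˡ (suc k) G {suc i} {zero}  a b eq
  with trans (sym (splitAt-↑ˡ (N (G zero)) b _)) (trans (cong (splitAt (N (G zero))) (sym eq)) (splitAt-↑ʳ (N (G zero)) _ _))
... | ()
emb-injectiveˡ (suc k) G {suc i} {suc j} a b eq =
  cong suc (emb-injectiveˡ k (G ∘ suc) a b (↑ʳ-injective (N (G zero)) _ _ eq))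

emb-injectiveʳ : ∀ k (G : Fin k → Graph) i {a b} → emb k G i a ≡ emb k G i b → a ≡ b
emb-injectiveʳ (suc k) G zero    eq = ↑ˡ-injective _ _ _ eq
emb-injectiveʳ (suc k) G (suc i) eq = emb-injectiveʳ k (G ∘ suc) i (↑ʳ-injective (N (G zero)) _ _ eq)

emb-surjective : ∀ k (G : Fin k → Graph) (x : Fin (total k G)) → ∃ λ i → ∃ λ y → emb k G i y ≡ x
emb-surjective (suc k) G x with splitAt (N (G zero)) x in split≡
... | inj₁ y = zero , y , trans (cong (join _ _) (sym split≡)) (join-splitAt (N (G zero)) _ x)
... | inj₂ z with emb-surjective k (G ∘ suc) z
...   | i , y , emb≡z = suc i , y ,
          trans (cong (N (G zero) ↑ʳ_) emb≡z) (trans (cong (join _ _) (sym split≡)) (join-splitAt (N (G zero)) _ x))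

sum-total : ∀ k (G : Fin k → Graph) (f : Fin (total k G) → ℕ) → sum f ≡ sum (λ i → sum (λ y → f (emb k G i y)))
sum-total zero    G f = refl
sum-total (suc k) G f =
  trans (sum-↑ (N (G zero)) _ f) (cong (sum (λ y → f (emb (suc k) G zero y)) +_) (sum-total k (G ∘ suc) _))

count-unionMinus : ∀ k (G : Fin k → Graph) (e : (i : Fin k) → Fin (length (E (G i))))
  (P : Fin (total k G) × Fin (total k G) → Bool)
  → count P (unionMinus k G e) ≡ sum (λ i → count (P ∘ embEdge k G i) (removeAt (E (G i)) (e i)))
count-unionMinus zero    G e P = refl
count-unionMinus (suc k) G e P = begin
  count P (map (embEdge (suc k) G zero) R₀ ++ map shift U)       ≡⟨ count-++ P (map (embEdge (suc k) G zero) R₀) (map shift U) ⟩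
  count P (map (embEdge (suc k) G zero) R₀) + count P (map shift U)
    ≡⟨ cong₂ _+_ (count-map P _ R₀) (trans (count-map P shift U) (count-unionMinus k (G ∘ suc) (e ∘ suc) (P ∘ shift))) ⟩
  sum (λ i → count (P ∘ embEdge (suc k) G i) (removeAt (E (G i)) (e i))) ∎
  where
  open ≡-Reasoning
  R₀ = removeAt (E (G zero)) (e zero)
  U  = unionMinus k (G ∘ suc) (e ∘ suc)
  shift : Fin (total k (G ∘ suc)) × Fin (total k (G ∘ suc)) → Fin (total (suc k) G) × Fin (total (suc k) G)
  shift p = N (G zero) ↑ʳ proj₁ p , N (G zero) ↑ʳ proj₂ p

map-nonloop : ∀ {M M'} (f : Fin M → Fin M') → (∀ {a b} → f a ≡ f b → a ≡ b)
  → {xs : List (Fin M × Fin M)} → All NonLoop xs → All NonLoop (map (λ p → f (proj₁ p) , f (proj₂ p)) xs)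
map-nonloop f f-injective xs-nonloop = map⁺ (All.map (λ a≢b fa≡fb → a≢b (f-injective fa≡fb)) xs-nonloop)

unionMinus-nonloop : ∀ k (G : Fin k → Graph) (e : (i : Fin k) → Fin (length (E (G i))))
  → (∀ i → Loopless (G i)) → All NonLoop (unionMinus k G e)
unionMinus-nonloop zero    G e loopless = []
unionMinus-nonloop (suc k) G e loopless =
  ++⁺ (map-nonloop _ (↑ˡ-injective _ _ _) (All-removeAt (E (G zero)) (e zero) (loopless zero)))
      (map-nonloop _ (↑ʳ-injective (N (G zero)) _ _) (unionMinus-nonloop k (G ∘ suc) (e ∘ suc) (loopless ∘ suc)))

module _ (k : ℕ) (G : Fin k → Graph) where

  emb-≟-same : ∀ i (y a : Fin (N (G i))) → ⌊ emb k G i y ≟ emb k G i a ⌋ ≡ ⌊ y ≟ a ⌋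
  emb-≟-same i y a with emb k G i y ≟ emb k G i a | y ≟ a
  ... | yes _      | yes _   = refl
  ... | yes emb≡   | no  y≢a = ⊥-elim (y≢a (emb-injectiveʳ k G i emb≡))
  ... | no  emb≢   | yes y≡a = ⊥-elim (emb≢ (cong (emb k G i) y≡a))
  ... | no  _      | no  _   = refl

  emb-≟-other : ∀ i j (y : Fin (N (G i))) (a : Fin (N (G j))) → j ≢ i → ⌊ emb k G i y ≟ emb k G j a ⌋ ≡ false
  emb-≟-other i j y a j≢i with emb k G i y ≟ emb k G j a
  ... | yes emb≡ = ⊥-elim (j≢i (sym (emb-injectiveˡ k G y a emb≡)))
  ... | no  _    = refl

  emb-≟-family : ∀ i (y : Fin (N (G i))) j (Z : (j : Fin k) → Fin (N (G j)))
    → ⌊ emb k G i y ≟ emb k G j (Z j) ⌋ ≡ ⌊ i ≟ j ⌋ ∧ ⌊ y ≟ Z i ⌋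
  emb-≟-family i y j Z with i ≟ j
  ... | yes refl = emb-≟-same i y (Z i)
  ... | no  i≢j  = emb-≟-other i j y (Z j) (i≢j ∘ sym)

  count-incident-unionMinus : (e : (i : Fin k) → Fin (length (E (G i)))) (i : Fin k) (y : Fin (N (G i)))
    → count (incident (emb k G i y)) (unionMinus k G e) ≡ count (incident y) (removeAt (E (G i)) (e i))
  count-incident-unionMinus e i y = begin
    count (incident (emb k G i y)) (unionMinus k G e)
      ≡⟨ count-unionMinus k G e (incident (emb k G i y)) ⟩
    sum (λ j → count (incident (emb k G i y) ∘ embEdge k G j) (removeAt (E (G j)) (e j)))
      ≡⟨ sum≡term _ i (λ j j≢i → count-zero (removeAt (E (G j)) (e j))
                                   (λ p → cong₂ _∨_ (emb-≟-other i j y _ j≢i) (emb-≟-other i j y _ j≢i))) ⟩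
    count (incident (emb k G i y) ∘ embEdge k G i) (removeAt (E (G i)) (e i))
      ≡⟨ count-cong (λ p → cong₂ _∨_ (emb-≟-same i y _) (emb-≟-same i y _)) (removeAt (E (G i)) (e i)) ⟩
    count (incident y) (removeAt (E (G i)) (e i)) ∎
    where open ≡-Reasoning

count-crosses-block≤ : ∀ k (G : Fin k → Graph) (e : (i : Fin k) → Fin (length (E (G i))))
  (X : Fin (total k G) → Bool) (i : Fin k)
  → count (crosses (X ∘ emb k G i)) (E (G i)) ≤ suc (count (crosses X) (unionMinus k G e))
count-crosses-block≤ k G e X i = begin
  count crossesᵢ (E (G i))                                ≡⟨ count-removeAt crossesᵢ (E (G i)) (e i) ⟩
  count crossesᵢ (removeAt (E (G i)) (e i)) + [ crossesᵢ (lookup (E (G i)) (e i)) ]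
                                                          ≤⟨ +-monoʳ-≤ _ ([]≤1 (crossesᵢ (lookup (E (G i)) (e i)))) ⟩
  count crossesᵢ (removeAt (E (G i)) (e i)) + 1           ≤⟨ +-monoˡ-≤ 1 (term≤sum _ i) ⟩
  sum (λ j → count (crosses X ∘ embEdge k G j) (removeAt (E (G j)) (e j))) + 1
                                                          ≡⟨ cong (_+ 1) (count-unionMinus k G e (crosses X)) ⟨
  count (crosses X) (unionMinus k G e) + 1                ≡⟨ +-comm _ 1 ⟩
  suc (count (crosses X) (unionMinus k G e))              ∎
  where
  open ≤-Reasoning
  crossesᵢ = crosses (X ∘ emb k G i)

restrict : ∀ k (G : Fin k → Graph) → Subset (total k G) → (i : Fin k) → Subset (N (G i))
restrict k G X i = tabulate (lookupᵛ X ∘ emb k G i)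

∣X∣≡∑∣restrict∣ : ∀ k (G : Fin k → Graph) (X : Subset (total k G))
  → ∣ X ∣ ≡ sum (λ i → ∣ restrict k G X i ∣)
∣X∣≡∑∣restrict∣ k G X = begin
  ∣ X ∣                                               ≡⟨ ∣X∣≡sum X ⟩
  sum (λ x → [ lookupᵛ X x ])                         ≡⟨ sum-total k G (λ x → [ lookupᵛ X x ]) ⟩
  sum (λ i → sum (λ y → [ lookupᵛ X (emb k G i y) ])) ≡⟨ sum-cong-≗ ∣restrict∣ ⟨
  sum (λ i → ∣ restrict k G X i ∣)                    ∎
  where
  open ≡-Reasoning
  ∣restrict∣ : ∀ i → ∣ restrict k G X i ∣ ≡ sum (λ y → [ lookupᵛ X (emb k G i y) ])
  ∣restrict∣ i = trans (∣X∣≡sum (restrict k G X i))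
                       (sum-cong-≗ (λ y → cong [_] (lookup∘tabulate (lookupᵛ X ∘ emb k G i) y)))

restrict-odd : ∀ k (G : Fin k → Graph) (X : Subset (total k G)) → ∣ X ∣ % 2 ≡ 1
  → ∃ λ i → ∣ restrict k G X i ∣ % 2 ≡ 1
restrict-odd k G X odd = sum-odd⇒term-odd _ (subst (λ t → t % 2 ≡ 1) (∣X∣≡∑∣restrict∣ k G X) odd)

-- The added edges

module AddedEdges (n : ℕ) (G : Fin (suc n) → Graph)
  (e : (i : Fin (suc n)) → Fin (length (E (G i))))
  (v w : (i : Fin (suc n)) → Fin (N (G i))) where

  -- `at v` and `at w` coincide with `vv` and `ww`.
  at : ((j : Fin (suc n)) → Fin (N (G j))) → ℕ → V n G e v w
  at Z m = emb (suc n) G (m mod suc n) (Z (m mod suc n))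

  at-≢ : 1 ≤ n → ∀ Z m m' → m' mod suc n ≡ suc m mod suc n → at Z m ≢ at Z m'
  at-≢ n≥1 Z m m' m'≡1+m at≡ = mod-suc-≢ n m n≥1 (trans (emb-injectiveˡ (suc n) G _ _ at≡) m'≡1+m)

  v≢w⇒emb-≢ : (∀ j → v j ≢ w j) → ∀ j j' → emb (suc n) G j (v j) ≢ emb (suc n) G j' (w j')
  v≢w⇒emb-≢ v≢w j j' emb≡ with emb-injectiveˡ (suc n) G {j} {j'} _ _ emb≡
  ... | refl = v≢w j (emb-injectiveʳ (suc n) G j emb≡)

  added≡addedEven : ∀ k → (n % 2 ≡ᵇ 0) ≡ true → n / 2 ≡ k → added n G e v w ≡ addedEven n G e v w k
  added≡addedEven k even n/2≡k =
    trans (cong (λ b → if b then addedEven n G e v w (n / 2) else addedOdd n G e v w (suc n / 2)) even)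
          (cong (addedEven n G e v w) n/2≡k)

  added≡addedOdd : ∀ k → (n % 2 ≡ᵇ 0) ≡ false → suc n / 2 ≡ suc k → added n G e v w ≡ addedOdd n G e v w (suc k)
  added≡addedOdd k odd [1+n]/2≡1+k =
    trans (cong (λ b → if b then addedEven n G e v w (n / 2) else addedOdd n G e v w (suc n / 2)) odd)
          (cong (addedOdd n G e v w) [1+n]/2≡1+k)

  %-mod-period : ∀ {d} .{{_ : NonZero d}} → d ≡ suc n → ∀ m → (m % d) mod suc n ≡ m mod suc n
  %-mod-period refl m = %-mod m (suc n)

  module _ (n≥1 : 1 ≤ n) (v≢w : ∀ j → v j ≢ w j) where

    pairEdges-nonloop : ∀ k f → (∀ m → f m mod suc n ≡ m mod suc n) → All NonLoop (pairEdges n G e v w k f)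
    pairEdges-nonloop k f f-mod = concat⁺ (map⁺ (applyUpTo⁺₂ _ k (λ j →
      at-≢ n≥1 v (2 * j) (1 + 2 * j) refl ∷ at-≢ n≥1 w (1 + 2 * j) (f (2 + 2 * j)) (f-mod (2 + 2 * j)) ∷ [])))

    added-nonloop : All NonLoop (added n G e v w)
    added-nonloop with even-or-odd n
    ... | inj₁ (k , even , n/2≡k , _) = subst (All NonLoop) (sym (added≡addedEven k even n/2≡k))
            (++⁺ (pairEdges-nonloop k (λ m → m) (λ m → refl)) (v≢w⇒emb-≢ v≢w ((2 * k) mod suc n) (0 mod suc n) ∷ []))
    ... | inj₂ (k , odd , [1+n]/2≡1+k , 2[1+k]≡1+n) = subst (All NonLoop) (sym (added≡addedOdd k odd [1+n]/2≡1+k))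
            (pairEdges-nonloop (suc k) (λ m → m % (2 * suc k)) (%-mod-period 2[1+k]≡1+n))

    module _ (i : Fin (suc n)) (y : Fin (N (G i))) where

      private
        x  = emb (suc n) G i y
        Vy = [ ⌊ y ≟ v i ⌋ ]
        Wy = [ ⌊ y ≟ w i ⌋ ]
        h : ℕ → ℕ
        h m = [ ⌊ i ≟ m mod suc n ⌋ ]

      [x≟at] : ∀ Z m → [ ⌊ x ≟ at Z m ⌋ ] ≡ h m * [ ⌊ y ≟ Z i ⌋ ]
      [x≟at] Z m = trans (cong [_] (emb-≟-family (suc n) G i y (m mod suc n) Z)) ([]-∧ ⌊ i ≟ m mod suc n ⌋ ⌊ y ≟ Z i ⌋)

      [incident-at] : ∀ Z m m' → m' mod suc n ≡ suc m mod suc n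
        → [ incident x (at Z m , at Z m') ] ≡ (h m + h (suc m)) * [ ⌊ y ≟ Z i ⌋ ]
      [incident-at] Z m m' m'≡1+m = begin
        [ incident x (at Z m , at Z m') ]               ≡⟨ [incident] x (at-≢ n≥1 Z m m' m'≡1+m) ⟩
        [ ⌊ x ≟ at Z m ⌋ ] + [ ⌊ x ≟ at Z m' ⌋ ]        ≡⟨ cong₂ _+_ ([x≟at] Z m) ([x≟at] Z m') ⟩
        h m * [ ⌊ y ≟ Z i ⌋ ] + h m' * [ ⌊ y ≟ Z i ⌋ ]  ≡⟨ cong (λ t → h m * _ + [ ⌊ i ≟ t ⌋ ] * _) m'≡1+m ⟩
        h m * [ ⌊ y ≟ Z i ⌋ ] + h (suc m) * [ ⌊ y ≟ Z i ⌋ ] ≡⟨ *-distribʳ-+ _ (h m) (h (suc m)) ⟨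
        (h m + h (suc m)) * [ ⌊ y ≟ Z i ⌋ ]             ∎
        where open ≡-Reasoning

      count-pairEdges : ∀ f → (∀ m → f m mod suc n ≡ m mod suc n) → ∀ k
        → count (incident x) (pairEdges n G e v w k f) ≡ sumBelow h (2 * k) * Vy + sumBelow (h ∘ suc) (2 * k) * Wy
      count-pairEdges f f-mod zero    = refl
      count-pairEdges f f-mod (suc k) = begin
        count (incident x) (pairEdges n G e v w (suc k) f)
          ≡⟨ cong (count (incident x)) (concatMap-upTo-suc pair k) ⟩
        count (incident x) (pairEdges n G e v w k f ++ pair k)
          ≡⟨ count-++ (incident x) (pairEdges n G e v w k f) (pair k) ⟩
        count (incident x) (pairEdges n G e v w k f) + count (incident x) (pair k)
          ≡⟨ cong₂ _+_ (count-pairEdges f f-mod k) count-pair ⟩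
        sumBelow h (2 * k) * Vy + sumBelow (h ∘ suc) (2 * k) * Wy
          + ((h (2 * k) + h (1 + 2 * k)) * Vy + ((h (1 + 2 * k) + h (2 + 2 * k)) * Wy + 0))
          ≡⟨ regroup (sumBelow h (2 * k)) (sumBelow (h ∘ suc) (2 * k)) (h (2 * k)) (h (1 + 2 * k)) (h (2 + 2 * k)) Vy Wy ⟩
        sumBelow h (2 + 2 * k) * Vy + sumBelow (h ∘ suc) (2 + 2 * k) * Wy
          ≡⟨ cong (λ t → sumBelow h t * Vy + sumBelow (h ∘ suc) t * Wy) (*-suc 2 k) ⟨
        sumBelow h (2 * suc k) * Vy + sumBelow (h ∘ suc) (2 * suc k) * Wy ∎
        where
        open ≡-Reasoning
        pair : ℕ → List (V n G e v w × V n G e v w)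
        pair j = (at v (2 * j) , at v (1 + 2 * j)) ∷ (at w (1 + 2 * j) , at w (f (2 + 2 * j))) ∷ []
        count-pair : count (incident x) (pair k)
                   ≡ (h (2 * k) + h (1 + 2 * k)) * Vy + ((h (1 + 2 * k) + h (2 + 2 * k)) * Wy + 0)
        count-pair = trans (count-∷ (incident x) _ _) (cong₂ _+_
          ([incident-at] v (2 * k) (1 + 2 * k) refl)
          (trans (count-∷ (incident x) _ []) (cong (_+ 0) ([incident-at] w (1 + 2 * k) (f (2 + 2 * k)) (f-mod (2 + 2 * k))))))
        regroup : ∀ S S' a b c V W → S * V + S' * W + ((a + b) * V + ((b + c) * W + 0))
                                   ≡ (S + a + b) * V + (S' + b + c) * W
        regroup = solve-∀

      each-index-once : sumBelow h (suc n) * Vy + sumBelow h (suc n) * Wy ≡ Vy + Wy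
      each-index-once = begin
        sumBelow h (suc n) * Vy + sumBelow h (suc n) * Wy
          ≡⟨ cong (λ t → t * Vy + t * Wy) (sumBelow-mod-indicator n i) ⟩
        1 * Vy + 1 * Wy
          ≡⟨ cong₂ _+_ (*-identityˡ Vy) (*-identityˡ Wy) ⟩
        Vy + Wy ∎
        where open ≡-Reasoning

      count-incident-added : count (incident x) (added n G e v w) ≡ Vy + Wy
      count-incident-added with even-or-odd n
      ... | inj₁ (k , even , n/2≡k , 2k≡n) = begin
        count (incident x) (added n G e v w)
          ≡⟨ cong (count (incident x)) (added≡addedEven k even n/2≡k) ⟩
        count (incident x) (pairEdges n G e v w k (λ m → m) ++ closing ∷ [])
          ≡⟨ count-++ (incident x) (pairEdges n G e v w k (λ m → m)) (closing ∷ []) ⟩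
        count (incident x) (pairEdges n G e v w k (λ m → m)) + count (incident x) (closing ∷ [])
          ≡⟨ cong₂ _+_ (count-pairEdges (λ m → m) (λ m → refl) k)
                       (trans (count-∷ (incident x) closing []) (cong (_+ 0) [incident-closing])) ⟩
        sumBelow h (2 * k) * Vy + sumBelow (h ∘ suc) (2 * k) * Wy + (h (2 * k) * Vy + h 0 * Wy + 0)
          ≡⟨ regroup (sumBelow h (2 * k)) (sumBelow (h ∘ suc) (2 * k)) (h (2 * k)) (h 0) Vy Wy ⟩
        (sumBelow h (2 * k) + h (2 * k)) * Vy + (h 0 + sumBelow (h ∘ suc) (2 * k)) * Wy
          ≡⟨ cong (λ t → (sumBelow h (2 * k) + h (2 * k)) * Vy + t * Wy) (sumBelow-shift h (2 * k)) ⟩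
        sumBelow h (suc (2 * k)) * Vy + sumBelow h (suc (2 * k)) * Wy
          ≡⟨ cong (λ t → sumBelow h (suc t) * Vy + sumBelow h (suc t) * Wy) 2k≡n ⟩
        sumBelow h (suc n) * Vy + sumBelow h (suc n) * Wy
          ≡⟨ each-index-once ⟩
        Vy + Wy ∎
        where
        open ≡-Reasoning
        closing = at v (2 * k) , at w 0
        [incident-closing] : [ incident x closing ] ≡ h (2 * k) * Vy + h 0 * Wy
        [incident-closing] = trans ([incident] x (v≢w⇒emb-≢ v≢w ((2 * k) mod suc n) (0 mod suc n)))
                                   (cong₂ _+_ ([x≟at] v (2 * k)) ([x≟at] w 0))
        regroup : ∀ S S' a b V W → S * V + S' * W + (a * V + b * W + 0) ≡ (S + a) * V + (b + S') * W
        regroup = solve-∀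
      ... | inj₂ (k , odd , [1+n]/2≡1+k , 2[1+k]≡1+n) = begin
        count (incident x) (added n G e v w)
          ≡⟨ cong (count (incident x)) (added≡addedOdd k odd [1+n]/2≡1+k) ⟩
        count (incident x) (pairEdges n G e v w (suc k) (λ m → m % (2 * suc k)))
          ≡⟨ count-pairEdges (λ m → m % (2 * suc k)) (%-mod-period 2[1+k]≡1+n) (suc k) ⟩
        sumBelow h (2 * suc k) * Vy + sumBelow (h ∘ suc) (2 * suc k) * Wy
          ≡⟨ cong (λ t → sumBelow h t * Vy + sumBelow (h ∘ suc) t * Wy) 2[1+k]≡1+n ⟩
        sumBelow h (suc n) * Vy + sumBelow (h ∘ suc) (suc n) * Wy
          ≡⟨ cong (λ t → sumBelow h (suc n) * Vy + t * Wy)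
                  (sumBelow-rotate h (suc n) (cong (λ j → [ ⌊ i ≟ j ⌋ ]) ([1+n]mod[1+n]≡0 n))) ⟩
        sumBelow h (suc n) * Vy + sumBelow h (suc n) * Wy
          ≡⟨ each-index-once ⟩
        Vy + Wy ∎
        where open ≡-Reasoning

-- Sums of s-graphs

endpoints-distinct : ∀ (G : Graph) (k : Fin (length (E G))) {a b} → Loopless G
  → lookup (E G) k ≡ (a , b) ⊎ lookup (E G) k ≡ (b , a) → a ≢ b
endpoints-distinct G k loopless (inj₁ eₖ≡ab)     = subst NonLoop eₖ≡ab (All.lookup loopless (∈-lookup k))
endpoints-distinct G k loopless (inj₂ eₖ≡ba) a≡b = subst NonLoop eₖ≡ba (All.lookup loopless (∈-lookup k)) (sym a≡b)

[incident-endpoints] : ∀ {M} (y : Fin M) {ε : Fin M × Fin M} {a b} → a ≢ b → ε ≡ (a , b) ⊎ ε ≡ (b , a)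
  → [ incident y ε ] ≡ [ ⌊ y ≟ a ⌋ ] + [ ⌊ y ≟ b ⌋ ]
[incident-endpoints] y a≢b (inj₁ refl) = [incident] y a≢b
[incident-endpoints] y {a = a} {b} a≢b (inj₂ refl) =
  trans ([incident] y (a≢b ∘ sym)) (+-comm [ ⌊ y ≟ b ⌋ ] [ ⌊ y ≟ a ⌋ ])

module _ (n s : ℕ) (n≥1 : 1 ≤ n) (G : Fin (suc n) → Graph)
  (e : (i : Fin (suc n)) → Fin (length (E (G i))))
  (v w : (i : Fin (suc n)) → Fin (N (G i)))
  (eᵢ≡vw : ∀ i → lookup (E (G i)) (e i) ≡ (v i , w i) ⊎ lookup (E (G i)) (e i) ≡ (w i , v i))
  (sGraphs : ∀ i → IsSGraph s (G i)) where

  open AddedEdges n G e v w using (added-nonloop; count-incident-added)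

  private
    sumGraph = SumGraph n G e v w

    v≢w : ∀ i → v i ≢ w i
    v≢w i = endpoints-distinct (G i) (e i) (IsSGraph.loopless (sGraphs i)) (eᵢ≡vw i)

  SumGraph-loopless : Loopless sumGraph
  SumGraph-loopless = ++⁺ (unionMinus-nonloop (suc n) G e (IsSGraph.loopless ∘ sGraphs)) (added-nonloop n≥1 v≢w)

  SumGraph-regular : ∀ x → degree sumGraph x ≡ s
  SumGraph-regular x with emb-surjective (suc n) G x
  ... | i , y , refl = begin
    count (incident xᵢ) (unionMinus (suc n) G e ++ added n G e v w)
      ≡⟨ count-++ (incident xᵢ) (unionMinus (suc n) G e) (added n G e v w) ⟩
    count (incident xᵢ) (unionMinus (suc n) G e) + count (incident xᵢ) (added n G e v w)
      ≡⟨ cong₂ _+_ (count-incident-unionMinus (suc n) G e i y) (count-incident-added n≥1 v≢w i y) ⟩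
    count (incident y) Rᵢ + ([ ⌊ y ≟ v i ⌋ ] + [ ⌊ y ≟ w i ⌋ ])
      ≡⟨ cong (count (incident y) Rᵢ +_) ([incident-endpoints] y (v≢w i) (eᵢ≡vw i)) ⟨
    count (incident y) Rᵢ + [ incident y (lookup (E (G i)) (e i)) ]
      ≡⟨ count-removeAt (incident y) (E (G i)) (e i) ⟨
    degree (G i) y
      ≡⟨ IsSGraph.regular (sGraphs i) y ⟩
    s ∎
    where
    open ≡-Reasoning
    xᵢ = emb (suc n) G i y
    Rᵢ = removeAt (E (G i)) (e i)

  SumGraph-oddCuts : ∀ X → ∣ X ∣ % 2 ≡ 1 → s ≤ cutSize sumGraph X
  SumGraph-oddCuts X odd with restrict-odd (suc n) G X odd
  ... | i , Xᵢ-odd = ≤-suc-same-parity⇒≤ s (cutSize sumGraph X) s≤1+cut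
                       (cutSize-parity sumGraph SumGraph-loopless SumGraph-regular X odd)
    where
    open ≤-Reasoning
    Xᵢ = restrict (suc n) G X i
    crossesX = crosses (lookupᵛ X)
    s≤1+cut : s ≤ suc (cutSize sumGraph X)
    s≤1+cut = begin
      s                                             ≤⟨ IsSGraph.oddCuts (sGraphs i) Xᵢ Xᵢ-odd ⟩
      cutSize (G i) Xᵢ                              ≡⟨ count-cong (λ p → cong₂ _xor_ (lookup∘tabulate _ (proj₁ p))
                                                                                (lookup∘tabulate _ (proj₂ p))) (E (G i)) ⟩
      count (crosses (lookupᵛ X ∘ emb (suc n) G i)) (E (G i))
                                                    ≤⟨ count-crosses-block≤ (suc n) G e (lookupᵛ X) i ⟩
      suc (count crossesX (unionMinus (suc n) G e)) ≤⟨ s≤s (m≤m+n _ _) ⟩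
      suc (count crossesX (unionMinus (suc n) G e) + count crossesX (added n G e v w))
                                                    ≡⟨ cong suc (count-++ crossesX (unionMinus (suc n) G e) (added n G e v w)) ⟨
      suc (cutSize sumGraph X)                       ∎

lemma2p10 : (n s : ℕ) → 1 ≤ n
    → (G : Fin (suc n) → Graph)
    → (e : (i : Fin (suc n)) → Fin (length (E (G i))))
    → (v w : (i : Fin (suc n)) → Fin (N (G i)))
    → (∀ i → (lookup (E (G i)) (e i) ≡ (v i , w i)) ⊎ (lookup (E (G i)) (e i) ≡ (w i , v i)))
    → (∀ i → IsSGraph s (G i))
    → IsSGraph s (SumGraph n G e v w)
lemma2p10 n s n≥1 G e v w eᵢ≡vw sGraphs = record
  { loopless = SumGraph-loopless n s n≥1 G e v w eᵢ≡vw sGraphs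
  ; regular  = SumGraph-regular  n s n≥1 G e v w eᵢ≡vw sGraphs
  ; oddCuts  = SumGraph-oddCuts  n s n≥1 G e v w eᵢ≡vw sGraphs
  }
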